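{- Assume Conjecture B (stated in the context). Then there is an integer $n_0$ such that for every integer $n\ge n_0$, the sequence of iterates $(S_{4,5}^k(n))_{k\ge0}$ diverges to infinity.
   Context: For integers $t\ge 0$, $b\ge 2$, the $t$-shifted Sloane map in base $b$ is $S_{t,b}(n)=\prod_{i=0}^k (d_i+t)$, where $n=\sum_{i=0}^k d_ib^i$ is the base-$b$ expansion of $n$ ($0\le d_i\le b-1$, $d_k>0$); $S_{t,b}^k$ is its $k$-th iterate. So $S_{4,5}$ replaces each base-5 digit $d$ by the factor $d+4$ and multiplies. For a base $q$, a digit $d$ and a positive integer $n$, $\#d(n)_q$ is the number of occurrences of $d$ in the base-$q$ expansion of $n$ and $\#(n)_q$ the number of base-$q$ digits of $n$. Given $\varepsilon>0$, $n$ is $\varepsilon$-equidistributed in base $q$ if $\left|\frac{\#d(n)_q}{\#(n)_q}-\frac1q\right|<\varepsilon$ for every $d\in\{0,\dots,q-1\}$. Conjecture B: For every integer $q>1$, every finite set $F=\{p_1,\dots,p_k\}$ of primes that does not contain all primes dividing $q$, and every positive integer $a$, for every $\varepsilon>0$ there exists $N$ such that $a\prod_{i=1}^k p_i^{\alpha_i}$ (nonnegative integers $\alpha_i$) is $\varepsilon$-equidistributed in base $q$ whenever $\alpha_i\ge N$ for some $i$. -}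

module Defs where

open import Data.Nat using (ℕ; zero; suc; _+_; _*_; _^_; _<_; _≤_; _≥_; _<ᵇ_; _≡ᵇ_)
open import Data.Nat.DivMod using (_/_; _%_)
open import Data.Nat.Divisibility using (_∣_)
open import Data.Nat.Primality using (Prime)
open import Data.Bool using (if_then_else_)
open import Data.List using (List; []; _∷_; length; map; filter; allFin)
open import Data.Nat.ListAction using (product)
open import Data.Fin using (Fin)
open import Data.Product using (Σ; _×_; ∃)
open import Data.Integer using (+_)
open import Data.Rational as ℚ using (ℚ; 0ℚ; ∣_∣)
open import Relation.Nullary using (¬_)
open import Relation.Binary.PropositionalEquality using (_≡_; _≢_)
open import Function.Definitions using (Injective)

-- Base-b digits of n, least significant first (fuel-based; fuel n+1 always suffices
-- for b ≥ 2). digits b 0 = [0]. Only b ≥ 2 is ever used.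
digitsFuel : ℕ → ℕ → ℕ → List ℕ
digitsFuel zero    b n = []
digitsFuel (suc f) zero n = n ∷ []
digitsFuel (suc f) (suc b) n =
  if n <ᵇ suc b then n ∷ [] else (n % suc b) ∷ digitsFuel f (suc b) (n / suc b)

digits : ℕ → ℕ → List ℕ
digits b n = digitsFuel (suc n) b n

countDigit : ℕ → ℕ → ℕ → ℕ
countDigit q d n = length (filter (λ x → Data.Nat._≟_ x d) (digits q n))

numDigits : ℕ → ℕ → ℕ
numDigits q n = length (digits q n)

-- x / y as a rational (y is always nonzero where used)
frac : ℕ → ℕ → ℚ
frac x zero    = 0ℚ
frac x (suc y) = (+ x) ℚ./ suc y

Equidistributed : ℕ → ℚ → ℕ → Set
Equidistributed q ε n =
  ∀ d → d < q → ∣ frac (countDigit q d n) (numDigits q n) ℚ.- frac 1 q ∣ ℚ.< ε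

primeProd : ∀ {k} → ℕ → (Fin k → ℕ) → (Fin k → ℕ) → ℕ
primeProd {k} a p α = a * product (map (λ i → p i ^ α i) (allFin k))

ConjectureB : Set
ConjectureB =
  ∀ (q : ℕ) → 1 < q →
  ∀ (k : ℕ) (p : Fin k → ℕ) → Injective _≡_ _≡_ p → (∀ i → Prime (p i)) →
  Σ ℕ (λ r → Prime r × r ∣ q × (∀ i → p i ≢ r)) →
  ∀ (a : ℕ) → 1 ≤ a →
  ∀ (ε : ℚ) → 0ℚ ℚ.< ε →
  Σ ℕ λ N → ∀ (α : Fin k → ℕ) → Σ (Fin k) (λ i → N ≤ α i) →
    Equidistributed q ε (primeProd a p α)

sloane : ℕ → ℕ → ℕ → ℕ
sloane t b n = product (map (λ d → d + t) (digits b n))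

iter : (ℕ → ℕ) → ℕ → ℕ → ℕ
iter f zero    n = n
iter f (suc k) n = f (iter f k n)

DivergesToInfinity : (ℕ → ℕ) → Set
DivergesToInfinity s = ∀ M → Σ ℕ λ K → ∀ k → K ≤ k → M ≤ s k

module Submission where

-- Every iterate of S = S_{4,5} is a number 5 ^ c * M with M = 2 ^ a * 3 ^ b * 7 ^ d (the digit
-- factors 4, ..., 8 have no other prime factors), and S(5 ^ c * M) = 4 ^ c * S(M). The potential
-- M ^ 10 * 5 ^ (8 c) lies between such a number and its tenth power, so it suffices that the potential
-- increases at every step once it exceeds a threshold.
-- If one of a, b, d is at least N, Conjecture B for the primes 2, 3, 7 (which miss 5) makes M
-- equidistributed in base 5 with ε = 1/50, so each digit value fills at least 9/50 of the L digits.
-- The potential of S(M) is the product of the digit weights (d + 4) ^ 10, except 5 ^ 8 for the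
-- digit 1, and these frequencies make it exceed 5 ^ (10 L) > M ^ 10; since 4 ^ 10 > 5 ^ 8, the
-- factor 4 ^ c of the next iterate keeps the contribution 5 ^ (8 c).
-- Otherwise M ≤ K = 2 ^ N * 3 ^ N * 7 ^ N, so a large potential forces c ≥ K ^ 10, and then
-- 4 ^ (10 c) > 2 ^ c * 5 ^ (8 c) > K ^ 10 * 5 ^ (8 c) makes the potential grow.

open import Defs
open import Data.Bool using (true; false; T)
open import Data.Empty using (⊥-elim)
open import Data.Fin using (Fin; zero; suc)
import Data.Integer as ℤ
import Data.Integer.Properties as ℤP
open import Data.List using (List; []; _∷_; length; map; filter; foldr; upTo)
open import Data.List.Properties using (filter-accept; filter-reject)
open import Data.List.Relation.Unary.All as All using (All; []; _∷_)
open import Data.List.Relation.Unary.All.Properties using (applyUpTo⁺₁)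
open import Data.Nat
open import Data.Nat.DivMod
open import Data.Nat.Divisibility using (∣-refl)
open import Data.Nat.GeneralisedArithmetic using (fold)
open import Data.Nat.ListAction using (product; sum)
open import Data.Nat.Primality using (Prime; prime?)
open import Data.Nat.Properties
import Data.Nat.Solver as ℕ-Solver
open import Data.Product using (Σ; _,_; _×_; proj₂)
open import Data.Rational as ℚ using (ℚ; 0ℚ)
import Data.Rational.Properties as ℚP
import Data.Rational.Solver as ℚ-Solver
import Data.Rational.Unnormalised as ℚᵘ
import Data.Rational.Unnormalised.Properties as ℚᵘP
open import Data.Sum using (_⊎_; inj₁; inj₂; [_,_]′)
open import Function using (_∘_; id)
open import Function.Definitions using (Injective)
open import Relation.Binary.PropositionalEquality
open import Relation.Nullary using (yes; no)
open import Relation.Nullary.Decidable using (from-yes)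

open import Algebra.Properties.CommutativeSemigroup *-commutativeSemigroup
  using (interchange; x∙yz≈y∙xz; xy∙z≈yz∙x)
import Algebra.Properties.CommutativeSemigroup +-commutativeSemigroup as +-Props
open import Algebra.Properties.Group ℚP.+-0-group using (⁻¹-involutive)

private
  variable
    b f g m n t : ℕ

-- Digits in base 2 + b and the shifted Sloane map

private
  <ᵇ-true : (m <ᵇ n) ≡ true → m < n
  <ᵇ-true {m} {n} eq = <ᵇ⇒< m n (subst T (sym eq) _)

  <ᵇ-false : (m <ᵇ n) ≡ false → n ≤ m
  <ᵇ-false eq = ≮⇒≥ (λ m<n → subst T eq (<⇒<ᵇ m<n))

  /-shrinks : 2 + b ≤ n → n / (2 + b) < n
  /-shrinks {n = n@(suc _)} _ = m/n<m n _ (s≤s (s≤s z≤n))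

digitsFuel-irrelevant : n < f → n < g → digitsFuel f (2 + b) n ≡ digitsFuel g (2 + b) n
digitsFuel-irrelevant {n} {suc f} {suc g} {b} n<f n<g with n <ᵇ 2 + b in eq
... | true  = refl
... | false = cong (n % (2 + b) ∷_) (digitsFuel-irrelevant (shrink n<f) (shrink n<g))
  where
  shrink : ∀ {h} → n < suc h → n / (2 + b) < h
  shrink n<1+h = <-≤-trans (/-shrinks (<ᵇ-false eq)) (≤-pred n<1+h)

digitsFuel-< : ∀ f n → All (_< 2 + b) (digitsFuel f (2 + b) n)
digitsFuel-< zero n = []
digitsFuel-< {b} (suc f) n with n <ᵇ 2 + b in eq
... | true  = <ᵇ-true eq ∷ []
... | false = m%n<n n (2 + b) ∷ digitsFuel-< f (n / (2 + b))

<-base^length-digitsFuel : n < f → n < (2 + b) ^ length (digitsFuel f (2 + b) n)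
<-base^length-digitsFuel {n} {suc f} {b} n<f with n <ᵇ 2 + b in eq
... | true  = <-≤-trans (<ᵇ-true eq) (m≤m*n (2 + b) 1)
... | false = begin-strict
  n                       ≡⟨ m≡m%n+[m/n]*n n B ⟩
  n % B + n / B * B       <⟨ +-monoˡ-< (n / B * B) (m%n<n n B) ⟩
  B + n / B * B           ≡⟨ cong (B +_) (*-comm (n / B) B) ⟩
  B + B * (n / B)         ≡⟨ *-suc B (n / B) ⟨
  B * suc (n / B)         ≤⟨ *-monoʳ-≤ B (<-base^length-digitsFuel n/B<f) ⟩
  B * B ^ length (digitsFuel f B (n / B)) ∎
  where
  open ≤-Reasoning
  B = 2 + b
  n/B<f : n / B < f
  n/B<f = <-≤-trans (/-shrinks (<ᵇ-false eq)) (≤-pred n<f)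

<-base^length : ∀ n → n < (2 + b) ^ length (digits (2 + b) n)
<-base^length n = <-base^length-digitsFuel ≤-refl

base^≤⇒<length : (2 + b) ^ m ≤ n → m < length (digits (2 + b) n)
base^≤⇒<length {b} {m} {n} bᵐ≤n =
  ≰⇒> (λ length≤m → <⇒≱ (<-base^length n) (≤-trans (^-monoʳ-≤ (2 + b) length≤m) bᵐ≤n))

digits-*base : 0 < n → digits (2 + b) (n * (2 + b)) ≡ 0 ∷ digits (2 + b) n
digits-*base {n@(suc _)} {b} _ with n * (2 + b) <ᵇ 2 + b in eq
... | true  = ⊥-elim (<⇒≱ (<ᵇ-true eq) (m≤n*m (2 + b) n))
... | false = cong₂ _∷_ (m*n%n≡0 n (2 + b))
  (trans (cong (digitsFuel (n * (2 + b)) (2 + b)) (m*n/n≡m n (2 + b)))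
         (digitsFuel-irrelevant (m<m*n n (2 + b) (s≤s (s≤s z≤n))) ≤-refl))

sloane-*base : 0 < n → sloane t (2 + b) (n * (2 + b)) ≡ t * sloane t (2 + b) n
sloane-*base {t = t} 0<n = cong (λ ds → product (map (_+ t) ds)) (digits-*base 0<n)

sloane-base^* : ∀ c → 0 < n → sloane t (2 + b) ((2 + b) ^ c * n) ≡ t ^ c * sloane t (2 + b) n
sloane-base^* {n} {t} {b} zero _ = trans (cong (sloane t (2 + b)) (+-identityʳ n)) (sym (+-identityʳ _))
sloane-base^* {n} {t} {b} (suc c) 0<n = begin
  sloane t (2 + b) ((2 + b) * (2 + b) ^ c * n) ≡⟨ cong (sloane t (2 + b)) (xy∙z≈yz∙x (2 + b) ((2 + b) ^ c) n) ⟩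
  sloane t (2 + b) ((2 + b) ^ c * n * (2 + b)) ≡⟨ sloane-*base (*-mono-≤ (m^n>0 (2 + b) c) 0<n) ⟩
  t * sloane t (2 + b) ((2 + b) ^ c * n)       ≡⟨ cong (t *_) (sloane-base^* c 0<n) ⟩
  t * (t ^ c * sloane t (2 + b) n)             ≡⟨ *-assoc t (t ^ c) _ ⟨
  t * t ^ c * sloane t (2 + b) n               ∎
  where open ≡-Reasoning

^length≤product-map-+ : ∀ ds → t ^ length ds ≤ product (map (_+ t) ds)
^length≤product-map-+ [] = ≤-refl
^length≤product-map-+ {t} (d ∷ ds) = *-mono-≤ (m≤n+m t d) (^length≤product-map-+ ds)

n<m^n : 1 < m → ∀ n → n < m ^ n
n<m^n 1<m zero = s≤s z≤n
n<m^n {m} 1<m (suc n) = ≤-<-trans (n<m^n 1<m n) (^-monoʳ-< m 1<m (n<1+n n))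

^-distribʳ-* : ∀ x y n → (x * y) ^ n ≡ x ^ n * y ^ n
^-distribʳ-* x y zero    = refl
^-distribʳ-* x y (suc n) = trans (cong (x * y *_) (^-distribʳ-* x y n)) (interchange x y (x ^ n) (y ^ n))

^-^-comm : ∀ x m n → (x ^ m) ^ n ≡ (x ^ n) ^ m
^-^-comm x m n = trans (^-*-assoc x m n) (trans (cong (x ^_) (*-comm m n)) (sym (^-*-assoc x n m)))

^-cancelʳ-≤ : ∀ n .{{_ : NonZero n}} {a b} → a ^ n ≤ b ^ n → a ≤ b
^-cancelʳ-≤ n aⁿ≤bⁿ = ≮⇒≥ (λ b<a → <⇒≱ (^-monoˡ-< n b<a) aⁿ≤bⁿ)

^-excess-≤ : ∀ {m w α e} → m ≤ w → α ≤ e → w ^ α * m ^ (e ∸ α) ≤ w ^ e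
^-excess-≤ {m} {w} {α} {e} m≤w α≤e = begin
  w ^ α * m ^ (e ∸ α) ≤⟨ *-monoʳ-≤ (w ^ α) (^-monoˡ-≤ (e ∸ α) m≤w) ⟩
  w ^ α * w ^ (e ∸ α) ≡⟨ ^-distribˡ-+-* w α (e ∸ α) ⟨
  w ^ (α + (e ∸ α))   ≡⟨ cong (w ^_) (m+[n∸m]≡n α≤e) ⟩
  w ^ e               ∎
  where open ≤-Reasoning

product-map-^-≥ : ∀ {m α β} (w k : ℕ → ℕ) js → All (λ j → m ≤ w j × α ≤ β * k j) js →
  product (map w js) ^ α * m ^ sum (map (λ j → β * k j ∸ α) js) ≤ product (map (λ j → w j ^ k j) js) ^ β
product-map-^-≥ {α = α} {β} w k [] [] =
  ≤-reflexive (trans (*-identityʳ (1 ^ α)) (trans (^-zeroˡ α) (sym (^-zeroˡ β))))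
product-map-^-≥ {m} {α} {β} w k (j ∷ js) ((m≤w , α≤βk) ∷ p) = begin
  (w j * W) ^ α * m ^ (u + U)             ≡⟨ cong₂ _*_ (^-distribʳ-* (w j) W α) (^-distribˡ-+-* m u U) ⟩
  w j ^ α * W ^ α * (m ^ u * m ^ U)       ≡⟨ interchange (w j ^ α) (W ^ α) (m ^ u) (m ^ U) ⟩
  w j ^ α * m ^ u * (W ^ α * m ^ U)       ≤⟨ *-mono-≤ (^-excess-≤ m≤w α≤βk) (product-map-^-≥ {β = β} w k js p) ⟩
  w j ^ (β * k j) * P ^ β                 ≡⟨ cong (λ e → w j ^ e * P ^ β) (*-comm β (k j)) ⟩
  w j ^ (k j * β) * P ^ β                 ≡⟨ cong (_* P ^ β) (^-*-assoc (w j) (k j) β) ⟨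
  (w j ^ k j) ^ β * P ^ β                 ≡⟨ ^-distribʳ-* (w j ^ k j) P β ⟨
  (w j ^ k j * P) ^ β                     ∎
  where
  open ≤-Reasoning
  W = product (map w js)
  P = product (map (λ j → w j ^ k j) js)
  u = β * k j ∸ α
  U = sum (map (λ j → β * k j ∸ α) js)

sum-map-∸ : ∀ {α} (e : ℕ → ℕ) js → All (λ j → α ≤ e j) js →
  sum (map (λ j → e j ∸ α) js) + length js * α ≡ sum (map e js)
sum-map-∸ e [] [] = refl
sum-map-∸ {α} e (j ∷ js) (α≤e ∷ p) = begin
  (e j ∸ α) + U + (α + length js * α) ≡⟨ +-Props.interchange (e j ∸ α) U α (length js * α) ⟩
  (e j ∸ α) + α + (U + length js * α) ≡⟨ cong₂ _+_ (m∸n+n≡m α≤e) (sum-map-∸ e js p) ⟩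
  e j + sum (map e js)                 ∎
  where
  open ≡-Reasoning
  U = sum (map (λ j → e j ∸ α) js)

sum-map-*ˡ : ∀ β (k : ℕ → ℕ) js → sum (map (λ j → β * k j) js) ≡ β * sum (map k js)
sum-map-*ˡ β k []       = sym (*-zeroʳ β)
sum-map-*ˡ β k (j ∷ js) = trans (cong (β * k j +_) (sum-map-*ˡ β k js)) (sym (*-distribˡ-+ β (k j) _))

-- Digit counts

count : ℕ → List ℕ → ℕ
count j ds = length (filter (_≟ j) ds)

count-≡ : ∀ j ds → count j (j ∷ ds) ≡ suc (count j ds)
count-≡ j ds = cong length (filter-accept {P = _≡ j} (_≟ j) refl)

count-≢ : ∀ {d j} → d ≢ j → ∀ ds → count j (d ∷ ds) ≡ count j ds
count-≢ {j = j} d≢j ds = cong length (filter-reject {P = _≡ j} (_≟ j) d≢j)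

product-map-count-∷ : ∀ (f : ℕ → ℕ) d ds js →
  product (map (λ j → f j ^ count j (d ∷ ds)) js) ≡ f d ^ count d js * product (map (λ j → f j ^ count j ds) js)
product-map-count-∷ f d ds [] = refl
product-map-count-∷ f d ds (j ∷ js) with d ≟ j
... | yes refl rewrite count-≡ d ds | count-≡ d js =
  trans (cong (f d * f d ^ count d ds *_) (product-map-count-∷ f d ds js))
        (interchange (f d) (f d ^ count d ds) (f d ^ count d js) (product (map (λ j → f j ^ count j ds) js)))
... | no d≢j rewrite count-≢ d≢j ds | count-≢ (d≢j ∘ sym) js =
  trans (cong (f j ^ count j ds *_) (product-map-count-∷ f d ds js))
        (x∙yz≈y∙xz (f j ^ count j ds) (f d ^ count d js) (product (map (λ j → f j ^ count j ds) js)))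

sum-map-count-∷ : ∀ d ds js →
  sum (map (λ j → count j (d ∷ ds)) js) ≡ count d js + sum (map (λ j → count j ds) js)
sum-map-count-∷ d ds [] = refl
sum-map-count-∷ d ds (j ∷ js) with d ≟ j
... | yes refl rewrite count-≡ d ds | count-≡ d js =
  cong suc (trans (cong (count d ds +_) (sum-map-count-∷ d ds js))
                  (+-Props.x∙yz≈y∙xz (count d ds) (count d js) (sum (map (λ j → count j ds) js))))
... | no d≢j rewrite count-≢ d≢j ds | count-≢ (d≢j ∘ sym) js =
  trans (cong (count j ds +_) (sum-map-count-∷ d ds js))
        (+-Props.x∙yz≈y∙xz (count j ds) (count d js) (sum (map (λ j → count j ds) js)))

count-upTo5 : ∀ {d} → d < 5 → count d (upTo 5) ≡ 1
count-upTo5 {0} _ = refl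
count-upTo5 {1} _ = refl
count-upTo5 {2} _ = refl
count-upTo5 {3} _ = refl
count-upTo5 {4} _ = refl
count-upTo5 {suc (suc (suc (suc (suc _))))} (s≤s (s≤s (s≤s (s≤s (s≤s ())))))

product-map-count : ∀ (f : ℕ → ℕ) {ds} → All (_< 5) ds →
  product (map f ds) ≡ product (map (λ j → f j ^ count j ds) (upTo 5))
product-map-count f [] = refl
product-map-count f {d ∷ ds} (d<5 ∷ p) = begin
  f d * product (map f ds)
    ≡⟨ cong₂ _*_ (sym (trans (cong (f d ^_) (count-upTo5 d<5)) (*-identityʳ (f d)))) (product-map-count f p) ⟩
  f d ^ count d (upTo 5) * product (map (λ j → f j ^ count j ds) (upTo 5))
    ≡⟨ product-map-count-∷ f d ds (upTo 5) ⟨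
  product (map (λ j → f j ^ count j (d ∷ ds)) (upTo 5)) ∎
  where open ≡-Reasoning

length≡sum-map-count : ∀ {ds} → All (_< 5) ds → length ds ≡ sum (map (λ j → count j ds) (upTo 5))
length≡sum-map-count [] = refl
length≡sum-map-count {d ∷ ds} (d<5 ∷ p) = begin
  suc (length ds)                                       ≡⟨ cong₂ _+_ (sym (count-upTo5 d<5)) (length≡sum-map-count p) ⟩
  count d (upTo 5) + sum (map (λ j → count j ds) (upTo 5)) ≡⟨ sum-map-count-∷ d ds (upTo 5) ⟨
  sum (map (λ j → count j (d ∷ ds)) (upTo 5))          ∎
  where open ≡-Reasoning

-- Equidistributed numbers have balanced digit counts

p≤∣p∣ : ∀ p → p ℚ.≤ ℚ.∣ p ∣
p≤∣p∣ p with ℚP.∣p∣≡p∨∣p∣≡-p p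
... | inj₁ ∣p∣≡p  = ℚP.≤-reflexive (sym ∣p∣≡p)
... | inj₂ ∣p∣≡-p = ℚP.≤-trans p≤0 (ℚP.0≤∣p∣ p)
  where
  p≤0 : p ℚ.≤ 0ℚ
  p≤0 = subst (ℚ._≤ 0ℚ) (⁻¹-involutive p)
          (ℚP.neg-antimono-≤ (subst (0ℚ ℚ.≤_) ∣p∣≡-p (ℚP.0≤∣p∣ p)))

∣p-q∣<r⇒q-r<p : ∀ {p q r} → ℚ.∣ p ℚ.- q ∣ ℚ.< r → q ℚ.- r ℚ.< p
∣p-q∣<r⇒q-r<p {p} {q} {r} ∣p-q∣<r = begin-strict
  q ℚ.- r           <⟨ ℚP.+-monoʳ-< q -r<p-q ⟩
  q ℚ.+ (p ℚ.- q)   ≡⟨ solve 2 (λ p q → q :+ (p :- q) := p) refl p q ⟩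
  p                 ∎
  where
  open ℚP.≤-Reasoning
  open ℚ-Solver.+-*-Solver
  -r<p-q : ℚ.- r ℚ.< p ℚ.- q
  -r<p-q = subst (ℚ.- r ℚ.<_) (⁻¹-involutive (p ℚ.- q)) (ℚP.neg-antimono-<
    (ℚP.≤-<-trans (p≤∣p∣ _) (subst (ℚ._< r) (sym (ℚP.∣-p∣≡∣p∣ (p ℚ.- q))) ∣p-q∣<r)))

1/50 : ℚ
1/50 = ℤ.+ 1 ℚ./ 50

-- 1/5 - 1/50 = 9/50 < c / L.
frequency-lower-bound : ∀ c L → ℚ.∣ frac c L ℚ.- frac 1 5 ∣ ℚ.< 1/50 → 9 * L ≤ 50 * c
frequency-lower-bound c zero    _ = z≤n
frequency-lower-bound c (suc y) h = <⇒≤ (subst (9 * suc y <_) (*-comm c 50) (ℤP.drop‿+<+ 9L<c50))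
  where
  9/50<c/L : ℚᵘ.mkℚᵘ (ℤ.+ 9) 49 ℚᵘ.< ℚᵘ.mkℚᵘ (ℤ.+ c) y
  9/50<c/L = ℚᵘP.<-respʳ-≃ (ℚP.toℚᵘ-fromℚᵘ (ℚᵘ.mkℚᵘ (ℤ.+ c) y))
               (ℚP.toℚᵘ-mono-< (∣p-q∣<r⇒q-r<p {frac c (suc y)} {frac 1 5} {1/50} h))
  9L<c50 : ℤ.+ (9 * suc y) ℤ.< ℤ.+ (c * 50)
  9L<c50 = subst (ℤ.+ (9 * suc y) ℤ.<_) (sym (ℤP.pos-* c 50)) (ℚᵘP.drop-*<* 9/50<c/L)

Balanced : ℕ → Set
Balanced n = ∀ j → j < 5 → 9 * length (digits 5 n) ≤ 50 * count j (digits 5 n)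

equidistributed⇒balanced : ∀ {n} → Equidistributed 5 1/50 n → Balanced n
equidistributed⇒balanced {n} h j j<5 = frequency-lower-bound (countDigit 5 j n) (numDigits 5 n) (h j j<5)

-- The numbers 2 ^ a * 3 ^ b * 5 ^ c * 7 ^ d and their potential

primes : Fin 3 → ℕ
primes zero             = 2
primes (suc zero)       = 3
primes (suc (suc zero)) = 7

exponents : ℕ → ℕ → ℕ → Fin 3 → ℕ
exponents a b d zero             = a
exponents a b d (suc zero)       = b
exponents a b d (suc (suc zero)) = d

primes-injective : Injective _≡_ _≡_ primes
primes-injective {zero}           {zero}           _ = refl
primes-injective {suc zero}       {suc zero}       _ = refl
primes-injective {suc (suc zero)} {suc (suc zero)} _ = refl
primes-injective {zero}           {suc zero}       ()
primes-injective {zero}           {suc (suc zero)} ()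
primes-injective {suc zero}       {zero}           ()
primes-injective {suc zero}       {suc (suc zero)} ()
primes-injective {suc (suc zero)} {zero}           ()
primes-injective {suc (suc zero)} {suc zero}       ()

primes-prime : ∀ i → Prime (primes i)
primes-prime zero             = from-yes (prime? 2)
primes-prime (suc zero)       = from-yes (prime? 3)
primes-prime (suc (suc zero)) = from-yes (prime? 7)

primes≢5 : ∀ i → primes i ≢ 5
primes≢5 zero             ()
primes≢5 (suc zero)       ()
primes≢5 (suc (suc zero)) ()

-- 2 ^ a * 3 ^ b * 7 ^ d, in the form a·∏ pᵢ ^ αᵢ used by Conjecture B.
smooth : ℕ → ℕ → ℕ → ℕ
smooth a b d = primeProd 1 primes (exponents a b d)

smooth-+ : ∀ a b d a′ b′ d′ → smooth (a + a′) (b + b′) (d + d′) ≡ smooth a b d * smooth a′ b′ d′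
smooth-+ a b d a′ b′ d′ = begin
  1 * (2 ^ (a + a′) * (3 ^ (b + b′) * (7 ^ (d + d′) * 1)))
    ≡⟨ cong₂ (λ x y → 1 * (x * y)) (^-distribˡ-+-* 2 a a′)
         (cong₂ (λ y z → y * (z * 1)) (^-distribˡ-+-* 3 b b′) (^-distribˡ-+-* 7 d d′)) ⟩
  1 * (2 ^ a * 2 ^ a′ * (3 ^ b * 3 ^ b′ * (7 ^ d * 7 ^ d′ * 1)))
    ≡⟨ solve 6 (λ x y z x′ y′ z′ → con 1 :* (x :* x′ :* (y :* y′ :* (z :* z′ :* con 1)))
                  := con 1 :* (x :* (y :* (z :* con 1))) :* (con 1 :* (x′ :* (y′ :* (z′ :* con 1)))))
         refl (2 ^ a) (3 ^ b) (7 ^ d) (2 ^ a′) (3 ^ b′) (7 ^ d′) ⟩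
  smooth a b d * smooth a′ b′ d′ ∎
  where
  open ≡-Reasoning
  open ℕ-Solver.+-*-Solver

smooth-pos : ∀ a b d → 0 < smooth a b d
smooth-pos a b d = *-monoʳ-≤ 1 (*-mono-≤ (m^n>0 2 a) (*-mono-≤ (m^n>0 3 b) (*-mono-≤ (m^n>0 7 d) ≤-refl)))

smooth-mono : ∀ {a b d a′ b′ d′} → a ≤ a′ → b ≤ b′ → d ≤ d′ → smooth a b d ≤ smooth a′ b′ d′
smooth-mono a≤a′ b≤b′ d≤d′ = *-monoʳ-≤ 1
  (*-mono-≤ (^-monoʳ-≤ 2 a≤a′) (*-mono-≤ (^-monoʳ-≤ 3 b≤b′) (*-mono-≤ (^-monoʳ-≤ 7 d≤d′) ≤-refl)))

conjectureB⇒balanced : ConjectureB →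
  Σ ℕ λ N → ∀ {a b d} → N ≤ a ⊎ N ≤ b ⊎ N ≤ d → Balanced (smooth a b d)
conjectureB⇒balanced conjectureB with conjectureB 5 (s≤s (s≤s z≤n)) 3 primes primes-injective primes-prime
  (5 , from-yes (prime? 5) , ∣-refl , primes≢5) 1 (s≤s z≤n) 1/50 (ℚP.positive⁻¹ 1/50)
... | N , equidistributed = N , λ {a} {b} {d} large →
  equidistributed⇒balanced {smooth a b d} (equidistributed (exponents a b d) (someExponent large))
  where
  someExponent : ∀ {a b d} → N ≤ a ⊎ N ≤ b ⊎ N ≤ d → Σ (Fin 3) λ i → N ≤ exponents a b d i
  someExponent (inj₁ N≤a)        = zero , N≤a
  someExponent (inj₂ (inj₁ N≤b)) = suc zero , N≤b
  someExponent (inj₂ (inj₂ N≤d)) = suc (suc zero) , N≤d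

record Shape : Set where
  constructor shape
  field
    fives twos threes sevens : ℕ

value : Shape → ℕ
value (shape c a b d) = 5 ^ c * smooth a b d

potential : Shape → ℕ
potential (shape c a b d) = smooth a b d ^ 10 * 5 ^ (8 * c)

ε : Shape
ε = shape 0 0 0 0

_⊕_ : Shape → Shape → Shape
shape c a b d ⊕ shape c′ a′ b′ d′ = shape (c + c′) (a + a′) (b + b′) (d + d′)

value-⊕ : ∀ s s′ → value (s ⊕ s′) ≡ value s * value s′
value-⊕ (shape c a b d) (shape c′ a′ b′ d′) = begin
  5 ^ (c + c′) * smooth (a + a′) (b + b′) (d + d′)
    ≡⟨ cong₂ _*_ (^-distribˡ-+-* 5 c c′) (smooth-+ a b d a′ b′ d′) ⟩
  5 ^ c * 5 ^ c′ * (smooth a b d * smooth a′ b′ d′)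
    ≡⟨ interchange (5 ^ c) (5 ^ c′) _ _ ⟩
  5 ^ c * smooth a b d * (5 ^ c′ * smooth a′ b′ d′) ∎
  where open ≡-Reasoning

potential-⊕ : ∀ s s′ → potential (s ⊕ s′) ≡ potential s * potential s′
potential-⊕ (shape c a b d) (shape c′ a′ b′ d′) = begin
  smooth (a + a′) (b + b′) (d + d′) ^ 10 * 5 ^ (8 * (c + c′))
    ≡⟨ cong₂ _*_ (trans (cong (_^ 10) (smooth-+ a b d a′ b′ d′))
                        (^-distribʳ-* (smooth a b d) (smooth a′ b′ d′) 10))
                 (trans (cong (5 ^_) (*-distribˡ-+ 8 c c′)) (^-distribˡ-+-* 5 (8 * c) (8 * c′))) ⟩
  smooth a b d ^ 10 * smooth a′ b′ d′ ^ 10 * (5 ^ (8 * c) * 5 ^ (8 * c′))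
    ≡⟨ interchange (smooth a b d ^ 10) _ _ _ ⟩
  smooth a b d ^ 10 * 5 ^ (8 * c) * (smooth a′ b′ d′ ^ 10 * 5 ^ (8 * c′)) ∎
  where open ≡-Reasoning

potential-pos : ∀ s → 0 < potential s
potential-pos (shape c a b d) = *-mono-≤ (^-monoˡ-≤ 10 (smooth-pos a b d)) (m^n>0 5 (8 * c))

value≤potential : ∀ s → value s ≤ potential s
value≤potential (shape c a b d) = begin
  5 ^ c * smooth a b d            ≡⟨ *-comm (5 ^ c) (smooth a b d) ⟩
  smooth a b d * 5 ^ c            ≤⟨ *-mono-≤ (m≤m^n (smooth a b d)) (^-monoʳ-≤ 5 (m≤n*m c 8)) ⟩
  smooth a b d ^ 10 * 5 ^ (8 * c) ∎
  where
  open ≤-Reasoning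
  m≤m^n : ∀ m → m ≤ m ^ 10
  m≤m^n zero    = z≤n
  m≤m^n (suc m) = m≤m*n (suc m) (suc m ^ 9)

potential≤value^10 : ∀ s → potential s ≤ value s ^ 10
potential≤value^10 (shape c a b d) = begin
  M ^ 10 * 5 ^ (8 * c)   ≤⟨ *-monoʳ-≤ (M ^ 10) (^-monoʳ-≤ 5 (*-monoˡ-≤ c (≤ᵇ⇒≤ 8 10 _))) ⟩
  M ^ 10 * 5 ^ (10 * c)  ≡⟨ cong (λ e → M ^ 10 * 5 ^ e) (*-comm 10 c) ⟩
  M ^ 10 * 5 ^ (c * 10)  ≡⟨ cong (M ^ 10 *_) (^-*-assoc 5 c 10) ⟨
  M ^ 10 * (5 ^ c) ^ 10  ≡⟨ *-comm (M ^ 10) ((5 ^ c) ^ 10) ⟩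
  (5 ^ c) ^ 10 * M ^ 10  ≡⟨ ^-distribʳ-* (5 ^ c) M 10 ⟨
  (5 ^ c * M) ^ 10       ∎
  where
  open ≤-Reasoning
  M = smooth a b d

-- The Sloane map S_{4,5} on shapes

-- The factor d + 4 contributed by a base-5 digit d; the last clause is the digit 4.
digitShape : ℕ → Shape
digitShape 0 = shape 0 2 0 0
digitShape 1 = shape 1 0 0 0
digitShape 2 = shape 0 1 1 0
digitShape 3 = shape 0 0 0 1
digitShape _ = shape 0 3 0 0

value-digitShape : ∀ {d} → d < 5 → value (digitShape d) ≡ d + 4
value-digitShape {0} _ = refl
value-digitShape {1} _ = refl
value-digitShape {2} _ = refl
value-digitShape {3} _ = refl
value-digitShape {4} _ = refl
value-digitShape {suc (suc (suc (suc (suc _))))} (s≤s (s≤s (s≤s (s≤s (s≤s ())))))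

digitWeight : ℕ → ℕ
digitWeight d = potential (digitShape d)

digitsShape : List ℕ → Shape
digitsShape = foldr (λ d s → digitShape d ⊕ s) ε

value-digitsShape : ∀ {ds} → All (_< 5) ds → value (digitsShape ds) ≡ product (map (_+ 4) ds)
value-digitsShape []                = refl
value-digitsShape {d ∷ ds} (d<5 ∷ p) =
  trans (value-⊕ (digitShape d) _) (cong₂ _*_ (value-digitShape d<5) (value-digitsShape p))

potential-digitsShape : ∀ ds → potential (digitsShape ds) ≡ product (map digitWeight ds)
potential-digitsShape []       = refl
potential-digitsShape (d ∷ ds) =
  trans (potential-⊕ (digitShape d) _) (cong (digitWeight d *_) (potential-digitsShape ds))

sloaneShape : ℕ → Shape
sloaneShape n = digitsShape (digits 5 n)

sloane-sloaneShape : ∀ n → sloane 4 5 n ≡ value (sloaneShape n)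
sloane-sloaneShape n = sym (value-digitsShape (digitsFuel-< (suc n) n))

fourPower : ℕ → Shape
fourPower c = shape 0 (2 * c) 0 0

smooth-fourPower : ∀ c → smooth (2 * c) 0 0 ≡ 4 ^ c
smooth-fourPower c = trans (+-identityʳ _) (trans (*-identityʳ _) (sym (^-*-assoc 2 2 c)))

value-fourPower : ∀ c → value (fourPower c) ≡ 4 ^ c
value-fourPower c = trans (+-identityʳ _) (smooth-fourPower c)

potential-fourPower : ∀ c → potential (fourPower c) ≡ (4 ^ 10) ^ c
potential-fourPower c = trans (*-identityʳ _) (trans (cong (_^ 10) (smooth-fourPower c)) (^-^-comm 4 c 10))

-- S(5 ^ c * M) = 4 ^ c * S(M): each of the c trailing zeros contributes a factor 4.
step : Shape → Shape
step (shape c a b d) = fourPower c ⊕ sloaneShape (smooth a b d)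

sloane-value : ∀ s → sloane 4 5 (value s) ≡ value (step s)
sloane-value (shape c a b d) = begin
  sloane 4 5 (5 ^ c * M)                   ≡⟨ sloane-base^* c (smooth-pos a b d) ⟩
  4 ^ c * sloane 4 5 M                     ≡⟨ cong₂ _*_ (sym (value-fourPower c)) (sloane-sloaneShape M) ⟩
  value (fourPower c) * value (sloaneShape M) ≡⟨ value-⊕ (fourPower c) (sloaneShape M) ⟨
  value (step (shape c a b d))             ∎
  where
  open ≡-Reasoning
  M = smooth a b d

orbit : ℕ → ℕ → Shape
orbit n = fold (sloaneShape n) step

iter-sloane-orbit : ∀ n k → iter (sloane 4 5) (suc k) n ≡ value (orbit n k)
iter-sloane-orbit n zero    = sloane-sloaneShape n
iter-sloane-orbit n (suc k) = trans (cong (sloane 4 5) (iter-sloane-orbit n k)) (sloane-value (orbit n k))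

-- Growth of the potential

potential-step : ∀ c a b d →
  potential (step (shape c a b d)) ≡ (4 ^ 10) ^ c * potential (sloaneShape (smooth a b d))
potential-step c a b d = trans (potential-⊕ (fourPower c) (sloaneShape (smooth a b d)))
                               (cong (_* potential (sloaneShape (smooth a b d))) (potential-fourPower c))

5^8c≤[4^10]^c : ∀ c → 5 ^ (8 * c) ≤ (4 ^ 10) ^ c
5^8c≤[4^10]^c c = ≤-trans (≤-reflexive (sym (^-*-assoc 5 8 c))) (^-monoˡ-≤ c (≤ᵇ⇒≤ (5 ^ 8) (4 ^ 10) _))

5^8≤digitWeight : ∀ d → 5 ^ 8 ≤ digitWeight d
5^8≤digitWeight 0 = ≤ᵇ⇒≤ _ _ _
5^8≤digitWeight 1 = ≤-refl
5^8≤digitWeight 2 = ≤ᵇ⇒≤ _ _ _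
5^8≤digitWeight 3 = ≤ᵇ⇒≤ _ _ _
5^8≤digitWeight (suc (suc (suc (suc _)))) = ≤ᵇ⇒≤ _ _ _

-- Among L balanced digits each digit occurs at least 9L/50 times and every weight is at least 5 ^ 8,
-- so the weights multiply to at least G ^ (9L/50) * (5 ^ 8) ^ (L/10), with G the product of the five
-- weights; this inequality, raised to the power L/50, makes that at least 5 ^ (10 L).
5^500≤digitWeights : 5 ^ 500 ≤ product (map digitWeight (upTo 5)) ^ 9 * (5 ^ 8) ^ 5
5^500≤digitWeights = ≤ᵇ⇒≤ _ _ _

balanced⇒potential-≥ : ∀ {n} → Balanced n → (5 ^ length (digits 5 n)) ^ 10 ≤ potential (sloaneShape n)
balanced⇒potential-≥ {n} balanced = ^-cancelʳ-≤ 50 (begin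
  ((5 ^ L) ^ 10) ^ 50             ≡⟨ trans (^-*-assoc (5 ^ L) 10 50) (^-^-comm 5 L 500) ⟩
  (5 ^ 500) ^ L                   ≤⟨ ^-monoˡ-≤ L 5^500≤digitWeights ⟩
  (G ^ 9 * (5 ^ 8) ^ 5) ^ L       ≡⟨ ^-distribʳ-* (G ^ 9) ((5 ^ 8) ^ 5) L ⟩
  (G ^ 9) ^ L * ((5 ^ 8) ^ 5) ^ L ≡⟨ cong₂ _*_ (^-*-assoc G 9 L) (^-*-assoc (5 ^ 8) 5 L) ⟩
  G ^ (9 * L) * (5 ^ 8) ^ (5 * L) ≡⟨ cong (λ e → G ^ (9 * L) * (5 ^ 8) ^ e) excess≡5L ⟨
  G ^ (9 * L) * (5 ^ 8) ^ excess  ≤⟨ product-map-^-≥ {β = 50} digitWeight k (upTo 5) weights ⟩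
  W ^ 50                          ≡⟨ cong (_^ 50) (trans (sym (product-map-count digitWeight ds<5))
                                                         (sym (potential-digitsShape ds))) ⟩
  potential (sloaneShape n) ^ 50  ∎)
  where
  open ≤-Reasoning
  ds = digits 5 n
  ds<5 = digitsFuel-< (suc n) n
  L = length ds
  k = λ j → count j ds
  G = product (map digitWeight (upTo 5))
  W = product (map (λ j → digitWeight j ^ k j) (upTo 5))
  excess = sum (map (λ j → 50 * k j ∸ 9 * L) (upTo 5))
  weights : All (λ j → 5 ^ 8 ≤ digitWeight j × 9 * L ≤ 50 * k j) (upTo 5)
  weights = applyUpTo⁺₁ id 5 (λ {j} j<5 → 5^8≤digitWeight j , balanced j j<5)
  excess≡5L : excess ≡ 5 * L
  excess≡5L = +-cancelʳ-≡ (5 * (9 * L)) excess (5 * L) (begin-equality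
    excess + 5 * (9 * L)                    ≡⟨ sum-map-∸ (λ j → 50 * k j) (upTo 5) (All.map proj₂ weights) ⟩
    sum (map (λ j → 50 * k j) (upTo 5))     ≡⟨ sum-map-*ˡ 50 k (upTo 5) ⟩
    50 * sum (map k (upTo 5))               ≡⟨ cong (50 *_) (length≡sum-map-count ds<5) ⟨
    50 * L                                  ≡⟨ trans (*-distribʳ-+ L 5 45) (cong (5 * L +_) (*-assoc 5 9 L)) ⟩
    5 * L + 5 * (9 * L)                     ∎)

balanced⇒potential-increases : ∀ c a b d → Balanced (smooth a b d) →
  potential (shape c a b d) < potential (step (shape c a b d))
balanced⇒potential-increases c a b d balanced = begin-strict
  M ^ 10 * 5 ^ (8 * c)
    <⟨ *-monoˡ-< (5 ^ (8 * c)) {{m^n≢0 5 (8 * c)}} (^-monoˡ-< 10 (<-base^length M)) ⟩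
  (5 ^ length (digits 5 M)) ^ 10 * 5 ^ (8 * c)
    ≤⟨ *-mono-≤ (balanced⇒potential-≥ {M} balanced) (5^8c≤[4^10]^c c) ⟩
  potential (sloaneShape M) * (4 ^ 10) ^ c
    ≡⟨ *-comm (potential (sloaneShape M)) ((4 ^ 10) ^ c) ⟩
  (4 ^ 10) ^ c * potential (sloaneShape M)
    ≡⟨ potential-step c a b d ⟨
  potential (step (shape c a b d)) ∎
  where
  open ≤-Reasoning
  M = smooth a b d

bounded⇒potential-increases : ∀ {K} c a b d → smooth a b d ≤ K →
  K ^ 10 * 5 ^ (8 * K ^ 10) ≤ potential (shape c a b d) →
  potential (shape c a b d) < potential (step (shape c a b d))
bounded⇒potential-increases {K} c a b d M≤K large = begin-strict
  potential (shape c a b d)       ≤⟨ potential≤ c ⟩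
  K ^ 10 * 5 ^ (8 * c)            <⟨ *-monoˡ-< (5 ^ (8 * c)) {{m^n≢0 5 (8 * c)}}
                                       (<-≤-trans (n<m^n (s≤s (s≤s z≤n)) (K ^ 10)) (^-monoʳ-≤ 2 K¹⁰≤c)) ⟩
  2 ^ c * 5 ^ (8 * c)             ≡⟨ cong (2 ^ c *_) (^-*-assoc 5 8 c) ⟨
  2 ^ c * (5 ^ 8) ^ c             ≡⟨ ^-distribʳ-* 2 (5 ^ 8) c ⟨
  (2 * 5 ^ 8) ^ c                 ≤⟨ ^-monoˡ-≤ c (≤ᵇ⇒≤ (2 * 5 ^ 8) (4 ^ 10) _) ⟩
  (4 ^ 10) ^ c                    ≤⟨ m≤m*n ((4 ^ 10) ^ c) _ {{>-nonZero (potential-pos (sloaneShape (smooth a b d)))}} ⟩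
  (4 ^ 10) ^ c * potential (sloaneShape (smooth a b d)) ≡⟨ potential-step c a b d ⟨
  potential (step (shape c a b d)) ∎
  where
  open ≤-Reasoning
  potential≤ : ∀ c → potential (shape c a b d) ≤ K ^ 10 * 5 ^ (8 * c)
  potential≤ c = *-monoˡ-≤ (5 ^ (8 * c)) (^-monoˡ-≤ 10 M≤K)
  K¹⁰≤c : K ^ 10 ≤ c
  K¹⁰≤c = ≮⇒≥ λ c<K¹⁰ → <⇒≱ (≤-<-trans (potential≤ c)
    (*-monoʳ-< (K ^ 10) {{>-nonZero (^-monoˡ-≤ 10 (≤-trans (smooth-pos a b d) M≤K))}}
      (^-monoʳ-< 5 (s≤s (s≤s z≤n)) (*-monoʳ-< 8 c<K¹⁰)))) large

threshold : ℕ → ℕ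
threshold N = K ^ 10 * 5 ^ (8 * K ^ 10)
  where K = smooth N N N

large-or-bounded : ∀ N a b d → (N ≤ a ⊎ N ≤ b ⊎ N ≤ d) ⊎ smooth a b d ≤ smooth N N N
large-or-bounded N a b d with N ≤? a | N ≤? b | N ≤? d
... | yes N≤a | _       | _       = inj₁ (inj₁ N≤a)
... | no _    | yes N≤b | _       = inj₁ (inj₂ (inj₁ N≤b))
... | no _    | no _    | yes N≤d = inj₁ (inj₂ (inj₂ N≤d))
... | no N≰a  | no N≰b  | no N≰d  = inj₂ (smooth-mono (<⇒≤ (≰⇒> N≰a)) (<⇒≤ (≰⇒> N≰b)) (<⇒≤ (≰⇒> N≰d)))

potential-increases : ∀ N → (∀ {a b d} → N ≤ a ⊎ N ≤ b ⊎ N ≤ d → Balanced (smooth a b d)) →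
  ∀ s → threshold N ≤ potential s → potential s < potential (step s)
potential-increases N balanced (shape c a b d) large =
  [ (λ someLarge → balanced⇒potential-increases c a b d (balanced someLarge))
  , (λ M≤K → bounded⇒potential-increases c a b d M≤K large)
  ]′ (large-or-bounded N a b d)

-- Divergence

fold-increasing : ∀ {A : Set} (f : A → A) (h : A → ℕ) {B} → (∀ x → B ≤ h x → h x < h (f x)) →
  ∀ {x} → B ≤ h x → ∀ k → B + k ≤ h (fold x f k)
fold-increasing f h {B} increasing B≤hx zero    = ≤-trans (≤-reflexive (+-identityʳ B)) B≤hx
fold-increasing f h {B} increasing B≤hx (suc k) = ≤-trans (≤-reflexive (+-suc B k))
  (≤-<-trans ih (increasing _ (≤-trans (m≤m+n B k) ih)))
  where ih = fold-increasing f h increasing B≤hx k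

potential-sloaneShape-≥ : ∀ {B n} → 5 ^ B ≤ n → B ≤ potential (sloaneShape n)
potential-sloaneShape-≥ {B} {n} 5ᴮ≤n = begin
  B                    ≤⟨ <⇒≤ (base^≤⇒<length {b = 3} 5ᴮ≤n) ⟩
  L                    ≤⟨ <⇒≤ (n<m^n (s≤s (s≤s z≤n)) L) ⟩
  4 ^ L                ≤⟨ ^length≤product-map-+ (digits 5 n) ⟩
  sloane 4 5 n         ≡⟨ sloane-sloaneShape n ⟩
  value (sloaneShape n) ≤⟨ value≤potential (sloaneShape n) ⟩
  potential (sloaneShape n) ∎
  where
  open ≤-Reasoning
  L = length (digits 5 n)

linear-lower-bound⇒diverges : ∀ e .{{_ : NonZero e}} (s : ℕ → ℕ) →
  (∀ k → k ≤ s (suc k) ^ e) → DivergesToInfinity s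
linear-lower-bound⇒diverges e s bound T = suc (T ^ e) , λ where
  (suc k) (s≤s Tᵉ≤k) → ^-cancelʳ-≤ e (≤-trans Tᵉ≤k (bound k))

sloane-diverges-above : ∀ B → (∀ s → B ≤ potential s → potential s < potential (step s)) →
  ∀ n → 5 ^ B ≤ n → DivergesToInfinity (λ k → iter (sloane 4 5) k n)
sloane-diverges-above B increasing n 5ᴮ≤n = linear-lower-bound⇒diverges 10 _ λ k → begin
  k                                ≤⟨ m≤n+m k B ⟩
  B + k                            ≤⟨ fold-increasing step potential increasing (potential-sloaneShape-≥ 5ᴮ≤n) k ⟩
  potential (orbit n k)            ≤⟨ potential≤value^10 (orbit n k) ⟩
  value (orbit n k) ^ 10           ≡⟨ cong (_^ 10) (iter-sloane-orbit n k) ⟨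
  iter (sloane 4 5) (suc k) n ^ 10 ∎
  where open ≤-Reasoning

theorem17 : ConjectureB → Σ ℕ (λ n₀ → ∀ n → n₀ ≤ n → DivergesToInfinity (λ k → iter (sloane 4 5) k n))
theorem17 conjectureB with conjectureB⇒balanced conjectureB
... | N , balanced = 5 ^ threshold N , sloane-diverges-above (threshold N) (potential-increases N balanced)
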